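{- Let $M=(E,r)$ be a matroid, $\mathbb F_q$ a finite field, and $\alpha\in(\mathbb F_q^*)^E$. If $A^*\subseteq E$ has maximal cardinality among all subsets $A\subseteq E$ with $s(M|A;\alpha)\neq0$, then $r(A^*)=r(E)$.
   Context: $M|A$ is the restriction of $M$ to $A$ (rank function $r$ restricted to subsets of $A$); its bases are the sets $B\subseteq A$ with $r(B)=|B|=r(A)$. $s(M|A;\alpha)=\sum_B\prod_{e\in B}\alpha_e$ over all bases $B$ of $M|A$ (empty product $=1$). $\mathbb F_q^*$ denotes the nonzero elements of $\mathbb F_q$. -}

module Defs where

open import Level using (Level; _⊔_) renaming (suc to lsuc)
open import Data.Nat using (ℕ; zero; suc; _≤_; _≟_) renaming (_+_ to _+ℕ_)
open import Data.Bool using (Bool; true; false; if_then_else_)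
open import Data.Fin using (Fin)
import Data.Fin as Fin
open import Relation.Binary.PropositionalEquality using (_≡_)
open import Data.Vec using (Vec; []; _∷_)
open import Data.List using (List; []; _∷_; map; _++_)
open import Data.Product using (∃; _×_; _,_)
open import Relation.Nullary using (¬_; Dec; yes; no)
open import Relation.Nullary.Decidable using (_×-dec_; ⌊_⌋)
open import Algebra.Bundles using (CommutativeRing)
open import Data.Fin.Subset using (Subset; _⊆_; _∪_; _∩_; ∣_∣; ⊤; outside; inside)
open import Data.Fin.Subset.Properties using (_⊆?_)

record Field (c ℓ : Level) : Set (lsuc (c ⊔ ℓ)) where
  field
    commutativeRing : CommutativeRing c ℓ
  open CommutativeRing commutativeRing public
  field
    0≉1     : ¬ (0# ≈ 1#)
    inverse : ∀ x → ¬ (x ≈ 0#) → ∃ λ y → x * y ≈ 1#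

record FiniteField (c ℓ : Level) : Set (lsuc (c ⊔ ℓ)) where
  field
    field′ : Field c ℓ
  open Field field′ public
  field
    size      : ℕ
    enumerate : Fin size → Carrier
    complete  : ∀ x → ∃ λ i → enumerate i ≈ x

record Matroid (n : ℕ) : Set where
  field
    rank        : Subset n → ℕ
    rank-bound  : ∀ A → rank A ≤ ∣ A ∣
    rank-mono   : ∀ {A B} → A ⊆ B → rank A ≤ rank B
    rank-submod : ∀ A B → rank (A ∪ B) +ℕ rank (A ∩ B) ≤ rank A +ℕ rank B

allSubsets : (n : ℕ) → List (Subset n)
allSubsets zero    = [] ∷ []
allSubsets (suc n) =
  map (outside ∷_) (allSubsets n) ++ map (inside ∷_) (allSubsets n)

IsBasisOfRestriction : ∀ {n} → Matroid n → Subset n → Subset n → Set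
IsBasisOfRestriction M A B =
  B ⊆ A × (Matroid.rank M B ≡ ∣ B ∣) × (∣ B ∣ ≡ Matroid.rank M A)

isBasisOfRestriction? : ∀ {n} (M : Matroid n) A B →
                        Dec (IsBasisOfRestriction M A B)
isBasisOfRestriction? M A B =
  (B ⊆? A) ×-dec ((Matroid.rank M B ≟ ∣ B ∣) ×-dec (∣ B ∣ ≟ Matroid.rank M A))

-- The basis generating polynomial evaluated at α:
--   s(M|A; α) = Σ_{B basis of M|A} Π_{e ∈ B} α_e

module _ {c ℓ} (F : Field c ℓ) where
  open Field F

  prodOver : ∀ {n} → Subset n → (Fin n → Carrier) → Carrier
  prodOver []            α = 1#
  prodOver (outside ∷ B) α = prodOver B (λ i → α (Fin.suc i))
  prodOver (inside ∷ B)  α = α Fin.zero * prodOver B (λ i → α (Fin.suc i))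

  sumList : List Carrier → Carrier
  sumList []       = 0#
  sumList (x ∷ xs) = x + sumList xs

  s : ∀ {n} → Matroid n → Subset n → (Fin n → Carrier) → Carrier
  s {n} M A α = sumList (map term (allSubsets n))
    where
    term : Subset n → Carrier
    term B = if ⌊ isBasisOfRestriction? M A B ⌋ then prodOver B α else 0#

-- If r(A*) < r(E), some e ∉ A* has r(A* ∪ {e}) = r(A*) + 1, for otherwise
-- submodularity lets A* absorb E one element at a time without raising its rank.
-- For such an e the bases of M|(A* ∪ {e}) are exactly the sets B ∪ {e} with B a
-- basis of M|A*, so s(M|(A* ∪ {e}); α) = α_e · s(M|A*; α) ≠ 0, contradicting the
-- maximality of ∣A*∣.
module Submission where

open import Defs
open import Data.Nat using (ℕ; suc; _≤_; _≤?_)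
open import Data.Nat.Properties using (≤-antisym; 1+n≰n; module ≤-Reasoning)
open import Data.Fin using (Fin; zero; suc)
open import Data.Fin.Properties using (all?; ¬∀⟶∃¬)
open import Data.Fin.Subset
  using (Subset; ∣_∣; ⊤; _∈_; _∉_; _⊆_; _∪_; _∩_; inside; outside; ⁅_⁆)
open import Data.Fin.Subset.Properties
  using (⊆-refl; ⊆-trans; ⊆⊤; p⊆p∪q; q⊆p∪q; x∈p∪q⁺; x∈p∩q⁺; x∈⁅x⁆; ∣⁅x⁆∣≡1)
open import Data.Vec using (_∷_; _[_]≔_; here; there)
open import Data.Vec.Properties using ([]≔-updates)
open import Data.List using (List; []; _∷_; map; _++_; foldr; allFin)
open import Data.List.Relation.Unary.Any using (Any)
import Data.List.Membership.Propositional as List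
open import Data.List.Membership.Propositional.Properties using (∈-allFin)
open import Data.Bool using (if_then_else_)
open import Data.Sum using (_⊎_; inj₁; inj₂)
open import Data.Product using (_×_; _,_; ∃)
open import Data.Empty using (⊥-elim)
open import Function using (_∘_)
open import Relation.Nullary using (¬_; Dec; yes; no)
open import Relation.Nullary.Decidable using (⌊_⌋)
open import Relation.Binary.PropositionalEquality as ≡
  using (_≡_; refl; cong; cong₂; subst)

insert : ∀ {n} → Fin n → Subset n → Subset n
insert e A = A [ e ]≔ inside

∈-insert : ∀ {n} (e : Fin n) A → e ∈ insert e A
∈-insert e A = []≔-updates A e

⊆-insert : ∀ {n} (e : Fin n) A → A ⊆ insert e A
⊆-insert zero    (_ ∷ A) here      = here
⊆-insert zero    (_ ∷ A) (there p) = there p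
⊆-insert (suc e) (_ ∷ A) here      = here
⊆-insert (suc e) (_ ∷ A) (there p) = there (⊆-insert e A p)

∈-insert⁻ : ∀ {n} (e : Fin n) A {x} → x ∈ insert e A → x ≡ e ⊎ x ∈ A
∈-insert⁻ zero    (_ ∷ A) here      = inj₁ refl
∈-insert⁻ zero    (_ ∷ A) (there p) = inj₂ (there p)
∈-insert⁻ (suc e) (_ ∷ A) here      = inj₂ here
∈-insert⁻ (suc e) (_ ∷ A) (there p) with ∈-insert⁻ e A p
... | inj₁ x≡e = inj₁ (cong suc x≡e)
... | inj₂ x∈A = inj₂ (there x∈A)

insert-⊆ : ∀ {n} {e : Fin n} {A B} → e ∈ B → A ⊆ B → insert e A ⊆ B
insert-⊆ {e = e} {A} e∈B A⊆B p with ∈-insert⁻ e A p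
... | inj₁ refl = e∈B
... | inj₂ x∈A  = A⊆B x∈A

⊆-insert-∉ : ∀ {n} {e : Fin n} {A B} → e ∉ B → B ⊆ insert e A → B ⊆ A
⊆-insert-∉ {e = e} {A} e∉B B⊆ x∈B with ∈-insert⁻ e A (B⊆ x∈B)
... | inj₁ refl = ⊥-elim (e∉B x∈B)
... | inj₂ x∈A  = x∈A

∣insert∣ : ∀ {n} (e : Fin n) A → e ∉ A → ∣ insert e A ∣ ≡ suc ∣ A ∣
∣insert∣ zero    (outside ∷ A) _   = refl
∣insert∣ zero    (inside  ∷ A) e∉A = ⊥-elim (e∉A here)
∣insert∣ (suc e) (outside ∷ A) e∉A = ∣insert∣ e A (e∉A ∘ there)
∣insert∣ (suc e) (inside  ∷ A) e∉A = cong suc (∣insert∣ e A (e∉A ∘ there))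

module FieldProperties {c ℓ} (F : Field c ℓ) where
  open Field F hiding (zero) renaming (refl to ≈-refl)
  open import Relation.Binary.Reasoning.Setoid setoid

  *-nonzero : ∀ {x y} → ¬ x ≈ 0# → ¬ y ≈ 0# → ¬ x * y ≈ 0#
  *-nonzero {x} {y} x≉0 y≉0 xy≈0 with inverse x x≉0
  ... | z , xz≈1 = y≉0 (begin
    y             ≈⟨ sym (*-identityˡ y) ⟩
    1# * y        ≈⟨ *-congʳ (trans (sym xz≈1) (*-comm x z)) ⟩
    (z * x) * y   ≈⟨ *-assoc z x y ⟩
    z * (x * y)   ≈⟨ *-congˡ xy≈0 ⟩
    z * 0#        ≈⟨ zeroʳ z ⟩
    0#            ∎)

  Σ : ∀ {A : Set} → (A → Carrier) → List A → Carrier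
  Σ g xs = sumList F (map g xs)

  Σ-++ : ∀ {A : Set} (g : A → Carrier) xs ys → Σ g (xs ++ ys) ≈ Σ g xs + Σ g ys
  Σ-++ g []       ys = sym (+-identityˡ _)
  Σ-++ g (x ∷ xs) ys = trans (+-congˡ (Σ-++ g xs ys)) (sym (+-assoc _ _ _))

  Σ-map : ∀ {A B : Set} (g : B → Carrier) (f : A → B) xs → Σ g (map f xs) ≡ Σ (g ∘ f) xs
  Σ-map g f []       = refl
  Σ-map g f (x ∷ xs) = cong (g (f x) +_) (Σ-map g f xs)

  Σ-cong : ∀ {A : Set} {g h : A → Carrier} → (∀ x → g x ≈ h x) → ∀ xs → Σ g xs ≈ Σ h xs
  Σ-cong g≈h []       = ≈-refl
  Σ-cong g≈h (x ∷ xs) = +-cong (g≈h x) (Σ-cong g≈h xs)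

  Σ-zero : ∀ {A : Set} {g : A → Carrier} → (∀ x → g x ≈ 0#) → ∀ xs → Σ g xs ≈ 0#
  Σ-zero g≈0 []       = ≈-refl
  Σ-zero g≈0 (x ∷ xs) = trans (+-cong (g≈0 x) (Σ-zero g≈0 xs)) (+-identityˡ 0#)

  Σ-*ˡ : ∀ {A : Set} a (g : A → Carrier) xs → Σ (λ x → a * g x) xs ≈ a * Σ g xs
  Σ-*ˡ a g []       = sym (zeroʳ a)
  Σ-*ˡ a g (x ∷ xs) = trans (+-congˡ (Σ-*ˡ a g xs)) (sym (distribˡ a _ _))

  ΣSubsets : ∀ {n} → (Subset n → Carrier) → Carrier
  ΣSubsets {n} g = Σ g (allSubsets n)

  ΣSubsets-suc : ∀ {m} (g : Subset (suc m) → Carrier) →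
                 ΣSubsets g ≈ ΣSubsets (g ∘ (outside ∷_)) + ΣSubsets (g ∘ (inside ∷_))
  ΣSubsets-suc {m} g = trans (Σ-++ g (map (outside ∷_) subsets) (map (inside ∷_) subsets))
    (+-cong (reflexive (Σ-map g (outside ∷_) subsets)) (reflexive (Σ-map g (inside ∷_) subsets)))
    where
    subsets : List (Subset m)
    subsets = allSubsets m

  -- Reindexing along the bijection B ↦ insert e B from {B ∣ e ∉ B} to {B ∣ e ∈ B}.
  ΣSubsets-insert : ∀ {n} (e : Fin n) (g h : Subset n → Carrier) →
                    (∀ B → e ∉ B → g B ≈ 0#) → (∀ B → e ∈ B → h B ≈ 0#) →
                    (∀ B → e ∉ B → g (insert e B) ≈ h B) → ΣSubsets g ≈ ΣSubsets h
  ΣSubsets-insert {suc m} zero g h g≈0 h≈0 g≈h = begin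
    ΣSubsets g                                             ≈⟨ ΣSubsets-suc g ⟩
    ΣSubsets (g ∘ (outside ∷_)) + ΣSubsets (g ∘ (inside ∷_))
      ≈⟨ +-congʳ (Σ-zero (λ B → g≈0 _ λ ())  (allSubsets m)) ⟩
    0# + ΣSubsets (g ∘ (inside ∷_))                        ≈⟨ +-comm _ _ ⟩
    ΣSubsets (g ∘ (inside ∷_)) + 0#
      ≈⟨ +-cong (Σ-cong (λ B → g≈h (outside ∷ B) λ ()) (allSubsets m))
                (sym (Σ-zero (λ B → h≈0 _ here) (allSubsets m))) ⟩
    ΣSubsets (h ∘ (outside ∷_)) + ΣSubsets (h ∘ (inside ∷_)) ≈⟨ ΣSubsets-suc h ⟨
    ΣSubsets h                                             ∎
  ΣSubsets-insert {suc m} (suc e) g h g≈0 h≈0 g≈h = begin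
    ΣSubsets g                                             ≈⟨ ΣSubsets-suc g ⟩
    ΣSubsets (g ∘ (outside ∷_)) + ΣSubsets (g ∘ (inside ∷_)) ≈⟨ +-cong (tail outside) (tail inside) ⟩
    ΣSubsets (h ∘ (outside ∷_)) + ΣSubsets (h ∘ (inside ∷_)) ≈⟨ ΣSubsets-suc h ⟨
    ΣSubsets h                                             ∎
    where
    tail : ∀ b → ΣSubsets (g ∘ (b ∷_)) ≈ ΣSubsets (h ∘ (b ∷_))
    tail b = ΣSubsets-insert e _ _ (λ B e∉B → g≈0 _ λ { (there p) → e∉B p })
                                   (λ B e∈B → h≈0 _ (there e∈B))
                                   (λ B e∉B → g≈h _ λ { (there p) → e∉B p })

  prodOver-insert : ∀ {n} (e : Fin n) B (α : Fin n → Carrier) → e ∉ B →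
                    prodOver F (insert e B) α ≈ α e * prodOver F B α
  prodOver-insert zero    (outside ∷ B) α e∉B = ≈-refl
  prodOver-insert zero    (inside  ∷ B) α e∉B = ⊥-elim (e∉B here)
  prodOver-insert (suc e) (outside ∷ B) α e∉B = prodOver-insert e B (α ∘ suc) (e∉B ∘ there)
  prodOver-insert (suc e) (inside  ∷ B) α e∉B = begin
    a * prodOver F (insert e B) (α ∘ suc) ≈⟨ *-congˡ (prodOver-insert e B (α ∘ suc) (e∉B ∘ there)) ⟩
    a * (b * P)                           ≈⟨ *-assoc a b P ⟨
    (a * b) * P                           ≈⟨ *-congʳ (*-comm a b) ⟩
    (b * a) * P                           ≈⟨ *-assoc b a P ⟩
    b * (a * P)                           ∎
    where
    a b P : Carrier
    a = α zero
    b = α (suc e)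
    P = prodOver F B (α ∘ suc)

module MatroidProperties {n : ℕ} (M : Matroid n) where
  open Matroid M
  open Data.Nat using (_+_)
  open import Data.Nat.Properties
    using (≤-refl; ≤-trans; ≤-pred; ≰⇒>; +-cancelʳ-≤; +-mono-≤; +-monoʳ-≤; +-comm; m≤m+n; suc-injective)
  open ≤-Reasoning

  rank-insert-≤ : ∀ e A → rank (insert e A) ≤ suc (rank A)
  rank-insert-≤ e A = begin
    rank (insert e A)                   ≤⟨ rank-mono (insert-⊆ (x∈p∪q⁺ (inj₂ (x∈⁅x⁆ e))) (p⊆p∪q ⁅ e ⁆)) ⟩
    rank (A ∪ ⁅ e ⁆)                    ≤⟨ m≤m+n _ _ ⟩
    rank (A ∪ ⁅ e ⁆) + rank (A ∩ ⁅ e ⁆) ≤⟨ rank-submod A ⁅ e ⁆ ⟩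
    rank A + rank ⁅ e ⁆                 ≤⟨ +-monoʳ-≤ (rank A) (subst (rank ⁅ e ⁆ ≤_) (∣⁅x⁆∣≡1 e) (rank-bound ⁅ e ⁆)) ⟩
    rank A + 1                          ≡⟨ +-comm (rank A) 1 ⟩
    suc (rank A)                        ∎

  insertAll : List (Fin n) → Subset n → Subset n
  insertAll xs A = foldr insert A xs

  ⊆-insertAll : ∀ xs A → A ⊆ insertAll xs A
  ⊆-insertAll []       A = ⊆-refl
  ⊆-insertAll (x ∷ xs) A = ⊆-trans (⊆-insertAll xs A) (⊆-insert x _)

  ∈-insertAll : ∀ {xs} A {x} → x List.∈ xs → x ∈ insertAll xs A
  ∈-insertAll {y ∷ xs} A (Any.here refl) = ∈-insert y _
  ∈-insertAll {y ∷ xs} A (Any.there p)   = ⊆-insert y _ (∈-insertAll A p)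

  module _ (A : Subset n) (closed : ∀ e → rank (insert e A) ≤ rank A) where

    rank-insertAll : ∀ xs → rank (insertAll xs A) ≤ rank A
    rank-insertAll []       = ≤-refl
    rank-insertAll (x ∷ xs) = +-cancelʳ-≤ (rank A) _ _ (begin
      rank (insert x S) + rank A       ≤⟨ +-mono-≤ (rank-mono (insert-⊆ (x∈p∪q⁺ (inj₁ (∈-insert x A))) (q⊆p∪q _ S)))
                                                   (rank-mono (λ p → x∈p∩q⁺ (⊆-insert x A p , ⊆-insertAll xs A p))) ⟩
      rank (insert x A ∪ S) + rank (insert x A ∩ S) ≤⟨ rank-submod (insert x A) S ⟩
      rank (insert x A) + rank S       ≤⟨ +-mono-≤ (closed x) (rank-insertAll xs) ⟩
      rank A + rank A                  ∎)
      where
      S : Subset n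
      S = insertAll xs A

    rank-⊤-≤-closed : rank ⊤ ≤ rank A
    rank-⊤-≤-closed = ≤-trans (rank-mono (λ {x} _ → ∈-insertAll A (∈-allFin x)))
                              (rank-insertAll (allFin n))

  closed? : ∀ A e → Dec (rank (insert e A) ≤ rank A)
  closed? A e = rank (insert e A) ≤? rank A

  rank-⊤-≤⊎rank-insert≡suc : ∀ A → rank ⊤ ≤ rank A ⊎
                             ∃ λ e → e ∉ A × rank (insert e A) ≡ suc (rank A)
  rank-⊤-≤⊎rank-insert≡suc A with all? (closed? A)
  ... | yes closed = inj₁ (rank-⊤-≤-closed A closed)
  ... | no ¬closed with ¬∀⟶∃¬ n _ (closed? A) ¬closed
  ...   | e , ≰ = inj₂ (e , (λ e∈A → ≰ (rank-mono (insert-⊆ e∈A ⊆-refl)))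
                          , ≤-antisym (rank-insert-≤ e A) (≰⇒> ≰))

  module _ (A : Subset n) (e : Fin n) (e∉A : e ∉ A)
           (rank-increases : rank (insert e A) ≡ suc (rank A)) where

    ¬basis-∌ : ∀ B → e ∉ B → ¬ IsBasisOfRestriction M (insert e A) B
    ¬basis-∌ B e∉B (B⊆ , rB≡ , ∣B∣≡) = 1+n≰n (begin
      suc (rank A)       ≡⟨ rank-increases ⟨
      rank (insert e A)  ≡⟨ ∣B∣≡ ⟨
      ∣ B ∣              ≡⟨ rB≡ ⟨
      rank B             ≤⟨ rank-mono (⊆-insert-∉ e∉B B⊆) ⟩
      rank A             ∎)

    basis-insert⁻ : ∀ B → e ∉ B → IsBasisOfRestriction M (insert e A) (insert e B) →
                    IsBasisOfRestriction M A B
    basis-insert⁻ B e∉B (B⁺⊆ , rB⁺≡ , ∣B⁺∣≡) =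
      ⊆-insert-∉ e∉B (⊆-trans (⊆-insert e B) B⁺⊆) , rB≡ , ∣B∣≡
      where
      ∣B∣≡ : ∣ B ∣ ≡ rank A
      ∣B∣≡ = suc-injective (≡.trans (≡.sym (∣insert∣ e B e∉B)) (≡.trans ∣B⁺∣≡ rank-increases))
      rB≡ : rank B ≡ ∣ B ∣
      rB≡ = ≤-antisym (rank-bound B) (≤-pred (begin
        suc ∣ B ∣          ≡⟨ ∣insert∣ e B e∉B ⟨
        ∣ insert e B ∣     ≡⟨ rB⁺≡ ⟨
        rank (insert e B)  ≤⟨ rank-insert-≤ e B ⟩
        suc (rank B)       ∎))

    basis-insert⁺ : ∀ B → e ∉ B → IsBasisOfRestriction M A B →
                    IsBasisOfRestriction M (insert e A) (insert e B)
    basis-insert⁺ B e∉B (B⊆A , rB≡ , ∣B∣≡) =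
      insert-⊆ (∈-insert e A) (⊆-trans B⊆A (⊆-insert e A)) ,
      ≤-antisym (rank-bound B⁺) (begin
        ∣ B⁺ ∣        ≡⟨ ≡.trans (∣insert∣ e B e∉B) (cong suc ∣B∣≡) ⟩
        suc (rank A)  ≤⟨ lower ⟩
        rank B⁺       ∎) ,
      ≡.trans (∣insert∣ e B e∉B) (≡.trans (cong suc ∣B∣≡) (≡.sym rank-increases))
      where
      B⁺ : Subset n
      B⁺ = insert e B
      lower : suc (rank A) ≤ rank B⁺
      lower = +-cancelʳ-≤ (rank A) _ _ (begin
        suc (rank A) + rank A            ≡⟨ cong₂ _+_ (≡.sym rank-increases) (≡.sym (≡.trans rB≡ ∣B∣≡)) ⟩
        rank (insert e A) + rank B       ≤⟨ +-mono-≤ (rank-mono (insert-⊆ (x∈p∪q⁺ (inj₁ (∈-insert e B))) (q⊆p∪q B⁺ A)))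
                                                     (rank-mono (λ p → x∈p∩q⁺ (⊆-insert e B p , B⊆A p))) ⟩
        rank (B⁺ ∪ A) + rank (B⁺ ∩ A)    ≤⟨ rank-submod B⁺ A ⟩
        rank B⁺ + rank A                 ∎)

module BasisPolynomial {c ℓ} (F : Field c ℓ) {n : ℕ} (M : Matroid n)
                       (α : Fin n → Field.Carrier F) where
  open Field F hiding (zero) renaming (refl to ≈-refl)
  open FieldProperties F
  open MatroidProperties M
  open import Relation.Binary.Reasoning.Setoid setoid

  basisTerm : Subset n → Subset n → Carrier
  basisTerm A B = if ⌊ isBasisOfRestriction? M A B ⌋ then prodOver F B α else 0#

  s-insert : ∀ A e → e ∉ A → Matroid.rank M (insert e A) ≡ suc (Matroid.rank M A) →
             s F M (insert e A) α ≈ α e * s F M A α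
  s-insert A e e∉A rank-increases = begin
    ΣSubsets (basisTerm (insert e A))    ≈⟨ ΣSubsets-insert e _ _ avoiding containing inserted ⟩
    ΣSubsets (λ B → α e * basisTerm A B) ≈⟨ Σ-*ˡ (α e) (basisTerm A) (allSubsets n) ⟩
    α e * ΣSubsets (basisTerm A)         ∎
    where
    avoiding : ∀ B → e ∉ B → basisTerm (insert e A) B ≈ 0#
    avoiding B e∉B with isBasisOfRestriction? M (insert e A) B
    ... | yes basis = ⊥-elim (¬basis-∌ A e e∉A rank-increases B e∉B basis)
    ... | no _      = ≈-refl
    containing : ∀ B → e ∈ B → α e * basisTerm A B ≈ 0#
    containing B e∈B with isBasisOfRestriction? M A B
    ... | yes (B⊆A , _) = ⊥-elim (e∉A (B⊆A e∈B))
    ... | no _          = zeroʳ _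
    inserted : ∀ B → e ∉ B → basisTerm (insert e A) (insert e B) ≈ α e * basisTerm A B
    inserted B e∉B with isBasisOfRestriction? M (insert e A) (insert e B)
                      | isBasisOfRestriction? M A B
    ... | yes _  | yes _  = prodOver-insert e B α e∉B
    ... | no _   | no _   = sym (zeroʳ _)
    ... | yes B⁺-basis | no ¬B-basis = ⊥-elim (¬B-basis (basis-insert⁻ A e e∉A rank-increases B e∉B B⁺-basis))
    ... | no ¬B⁺-basis | yes B-basis = ⊥-elim (¬B⁺-basis (basis-insert⁺ A e e∉A rank-increases B e∉B B-basis))

lemma1 : ∀ {c ℓ} (F : FiniteField c ℓ) {n : ℕ} (M : Matroid n)
         (α : Fin n → FiniteField.Carrier F) →
         (∀ e → ¬ (FiniteField._≈_ F (α e) (FiniteField.0# F))) →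
         (A* : Subset n) →
         ¬ (FiniteField._≈_ F (s (FiniteField.field′ F) M A* α) (FiniteField.0# F)) →
         (∀ (A : Subset n) → ¬ (FiniteField._≈_ F (s (FiniteField.field′ F) M A α) (FiniteField.0# F)) → ∣ A ∣ ≤ ∣ A* ∣) →
         Matroid.rank M A* ≡ Matroid.rank M ⊤
lemma1 F M α α≉0 A* sA*≉0 maximal
  with MatroidProperties.rank-⊤-≤⊎rank-insert≡suc M A*
... | inj₁ ⊤≤A* = ≤-antisym (Matroid.rank-mono M ⊆⊤) ⊤≤A*
... | inj₂ (e , e∉A* , rank-increases) = ⊥-elim (1+n≰n (begin
  suc ∣ A* ∣         ≡⟨ ∣insert∣ e A* e∉A* ⟨
  ∣ insert e A* ∣    ≤⟨ maximal (insert e A*) sA*⁺≉0 ⟩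
  ∣ A* ∣             ∎))
  where
  open ≤-Reasoning
  field′ : Field _ _
  field′ = FiniteField.field′ F
  open Field field′ using (_≈_; 0#; sym; trans)
  sA*⁺≉0 : ¬ s field′ M (insert e A*) α ≈ 0#
  sA*⁺≉0 sA*⁺≈0 = FieldProperties.*-nonzero field′ (α≉0 e) sA*≉0
    (trans (sym (BasisPolynomial.s-insert field′ M α A* e e∉A* rank-increases)) sA*⁺≈0)
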